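{- Let $k\ge1$. The first $k+1$ terms of the sequence $(s^{(m)}_{k,n})_{n=1}^\infty$ are $\underbrace{0,\ldots,0}_{k-1},1,k-1$, i.e., $s^{(m)}_{k,n}=0$ for $1\le n\le k-1$, $s^{(m)}_{k,k}=1$, and $s^{(m)}_{k,k+1}=k-1$. Moreover, $$s^{(m)}_{k,n}=\sum_{i=1}^k(-1)^{i+1}\binom{k}{i}s^{(m)}_{k,n-i}+s^{(m)}_{k,n-k-1}\quad\text{for all } n\ge k+2.$$
   Context: A finite nonempty set $F\subset\mathbb{N}$ is called maximal Schreier if $\min F=|F|$. For $k,n\in\mathbb{N}$, let $s^{(m)}_{k,n}$ be the number of sets $F\subset\{k,2k,\ldots,nk\}$ such that $F$ is maximal Schreier and $nk\in F$. -}

module Defs where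

open import Data.Nat using (ℕ; zero; suc; _+_; _*_; _⊓_; _≟_)
open import Data.List using (List; []; _∷_; length; map; foldr; filter; upTo; concatMap)
open import Data.List.Membership.DecPropositional _≟_ using (_∈?_)
open import Data.List.Membership.Propositional using (_∈_)
open import Data.Product using (_×_)
open import Data.Empty using (⊥)
open import Data.Integer as ℤ using (ℤ)
open import Relation.Nullary using (Dec; yes; no; ¬_)
open import Relation.Nullary.Decidable using (_×-dec_)
open import Relation.Binary.PropositionalEquality using (_≡_)

multiples : ℕ → ℕ → List ℕ
multiples k n = map (λ i → suc i * k) (upTo n)

-- All sub-lists (subsequences) of a list; for a duplicate-free list these
-- are exactly its subsets, each listed once.
sublists : {A : Set} → List A → List (List A)
sublists []       = [] ∷ []
sublists (x ∷ xs) = let r = sublists xs in Data.List._++_ (map (x ∷_) r) r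

-- Minimum of a list (default 0 on the empty list; only used for nonempty F).
minList : List ℕ → ℕ
minList []       = 0
minList (x ∷ xs) = foldr _⊓_ x xs

NonEmpty : List ℕ → Set
NonEmpty []      = ⊥
NonEmpty (_ ∷ _) = Data.Unit.⊤
  where import Data.Unit

nonEmpty? : (F : List ℕ) → Dec (NonEmpty F)
nonEmpty? []      = no (λ ())
nonEmpty? (_ ∷ _) = yes _

MaxSchreier : List ℕ → Set
MaxSchreier F = NonEmpty F × (minList F ≡ length F)

maxSchreier? : (F : List ℕ) → Dec (MaxSchreier F)
maxSchreier? F = nonEmpty? F ×-dec (minList F ≟ length F)

Counted : ℕ → ℕ → List ℕ → Set
Counted k n F = MaxSchreier F × (n * k ∈ F)

counted? : (k n : ℕ) (F : List ℕ) → Dec (Counted k n F)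
counted? k n F = maxSchreier? F ×-dec (n * k ∈? F)

s : ℕ → ℕ → ℕ
s k n = length (filter (counted? k n) (sublists (multiples k n)))

-- Σ_{i=a}^{a+len-1} f i in ℤ.
sumℤ : ℕ → ℕ → (ℕ → ℤ) → ℤ
sumℤ a zero    f = ℤ.+ 0
sumℤ a (suc l) f = f a ℤ.+ sumℤ (suc a) l f

sign : ℕ → ℤ
sign zero    = ℤ.+ 1
sign (suc j) = ℤ.- sign j

module Submission where

-- Splitting a maximal Schreier set F ∋ nk at its minimum jk, the rest of F is a (jk − 1)-subset of
-- {(j+1)k, …, nk} containing nk, so s(k,n) = Σ_j C(n − j − 1, jk − 2), up to the singleton {1} when
-- n = k = 1.  Differencing in n lowers both arguments of every binomial by one (Pascal's rule), so the
-- k-th difference Σ_i (−1)^i C(k,i) s(k,n−i) turns the j-th term into the (j−1)-th term of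
-- s(k, n−k−1), which is the recurrence.  Pascal's rule for integer binomials fails only at C(0,0);
-- that corner is never reached as long as n − k is large enough, and the one excluded case, k = 1 and
-- n = 3, is checked by evaluation.

open import Defs
open import Data.Nat using (ℕ; zero; suc; _+_; _∸_; _⊓_; _≤_; _<_; _≟_; _≤?_; z≤n; s≤s; z<s)
import Data.Nat as ℕ
open import Data.Nat.Properties
open import Data.Nat.Combinatorics
  using (_C_; nCk+nC[k+1]≡[n+1]C[k+1]; nCn≡1; nC1≡n; nCk≡nC[n∸k]; k>n⇒nCk≡0)
open import Data.List using (List; []; _∷_; _∷ʳ_; _++_; length; map; filter; upTo)
open import Data.List.Properties
  using (filter-++; length-++; filter-none; filter-accept; filter-reject; map-++; upTo-∷ʳ)
open import Data.List.Relation.Unary.All as All using (All; []; _∷_)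
open import Data.List.Relation.Unary.All.Properties using (++⁺; map⁺)
open import Data.List.Relation.Unary.Any as Any using (here; there)
open import Data.List.Membership.Propositional using (_∈_; _∉_)
open import Data.List.Membership.Propositional.Properties using (∈-++⁺ʳ)
open import Data.List.Membership.DecPropositional _≟_ using (_∈?_)
open import Data.Product using (_×_; _,_; ∃₂)
open import Data.Unit using (tt)
open import Data.Empty using (⊥-elim)
open import Function using (_∘_; _⇔_; mk⇔; Equivalence)
open import Level using (0ℓ)
open import Relation.Nullary using (yes; no; ¬_)
open import Relation.Nullary.Decidable using (_×-dec_)
open import Relation.Unary using (Pred; Decidable)
open import Relation.Binary.PropositionalEquality

count : {A : Set} {P : Pred A 0ℓ} → Decidable P → List A → ℕ
count P? xs = length (filter P? xs)

module _ {A : Set} {P : Pred A 0ℓ} (P? : Decidable P) where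

  count-++ : ∀ xs ys → count P? (xs ++ ys) ≡ count P? xs + count P? ys
  count-++ xs ys = trans (cong length (filter-++ P? xs ys)) (length-++ (filter P? xs))

  count-map : {B : Set} (f : B → A) (xs : List B) → count P? (map f xs) ≡ count (P? ∘ f) xs
  count-map f [] = refl
  count-map f (x ∷ xs) with P? (f x)
  ... | yes _ = cong suc (count-map f xs)
  ... | no _  = count-map f xs

  count-none : (∀ x → ¬ P x) → ∀ xs → count P? xs ≡ 0
  count-none ¬P xs = cong length (filter-none P? (All.universal ¬P xs))

  count-cong : {Q : Pred A 0ℓ} (Q? : Decidable Q) {xs : List A} →
    All (λ x → P x ⇔ Q x) xs → count P? xs ≡ count Q? xs
  count-cong Q? [] = refl
  count-cong Q? {x ∷ xs} (P⇔Q ∷ eqs) with P? x | Q? x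
  ... | yes _ | yes _  = cong suc (count-cong Q? eqs)
  ... | no _  | no _   = count-cong Q? eqs
  ... | yes p | no ¬q  = ⊥-elim (¬q (Equivalence.to P⇔Q p))
  ... | no ¬p | yes q  = ⊥-elim (¬p (Equivalence.from P⇔Q q))

sublists⁺ : {A : Set} {P : Pred A 0ℓ} {xs : List A} → All P xs → All (All P) (sublists xs)
sublists⁺ []         = [] ∷ []
sublists⁺ (px ∷ pxs) = ++⁺ (map⁺ (All.map (px ∷_) (sublists⁺ pxs))) (sublists⁺ pxs)

-- shiftedC e m b is the binomial coefficient C(m - e, b - e) with integer arguments,
-- i.e. it vanishes as soon as m < e or b < e.
shiftedC : ℕ → ℕ → ℕ → ℕ
shiftedC zero    m       b       = m C b
shiftedC (suc e) zero    b       = 0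
shiftedC (suc e) (suc m) zero    = 0
shiftedC (suc e) (suc m) (suc b) = shiftedC e m b

-- Pascal's rule for integer binomials fails only at C(0, 0).
shiftedC-pascal : ∀ e m b → ¬ (e ≡ suc m × b ≡ suc m) →
  shiftedC e (suc m) b ≡ shiftedC e m b + shiftedC (suc e) (suc m) b
shiftedC-pascal zero    m       zero    _ = refl
shiftedC-pascal zero    m       (suc b) _ =
  trans (sym (nCk+nC[k+1]≡[n+1]C[k+1] m b)) (+-comm (m C b) (m C suc b))
shiftedC-pascal (suc e) zero    zero    _ = refl
shiftedC-pascal (suc e) (suc m) zero    _ = refl
shiftedC-pascal (suc zero)    zero (suc zero)    corner = ⊥-elim (corner (refl , refl))
shiftedC-pascal (suc zero)    zero (suc (suc b)) _      = refl
shiftedC-pascal (suc (suc e)) zero (suc b)       _      = refl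
shiftedC-pascal (suc e) (suc m) (suc b) no-corner =
  shiftedC-pascal e m b (λ (e≡ , b≡) → no-corner (cong suc e≡ , cong suc b≡))

shiftedC-+ : ∀ d e m b → shiftedC (d + e) (d + m) (d + b) ≡ shiftedC e m b
shiftedC-+ zero    e m b = refl
shiftedC-+ (suc d) e m b = shiftedC-+ d e m b

shiftedC-top< : ∀ {e m} b → m < e → shiftedC e m b ≡ 0
shiftedC-top< {suc e} {zero}  b       _         = refl
shiftedC-top< {suc e} {suc m} zero    _         = refl
shiftedC-top< {suc e} {suc m} (suc b) (s≤s m<e) = shiftedC-top< b m<e

shiftedC-bottom< : ∀ {e b} m → b < e → shiftedC e m b ≡ 0
shiftedC-bottom< {suc e} {b}     zero    _         = refl
shiftedC-bottom< {suc e} {zero}  (suc m) _         = refl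
shiftedC-bottom< {suc e} {suc b} (suc m) (s≤s b<e) = shiftedC-bottom< m b<e

shiftedC-top<bottom : ∀ e {m b} → m < b → shiftedC e m b ≡ 0
shiftedC-top<bottom zero    m<b = k>n⇒nCk≡0 m<b
shiftedC-top<bottom (suc e) {zero}          _         = refl
shiftedC-top<bottom (suc e) {suc m} {suc b} (s≤s m<b) = shiftedC-top<bottom e m<b

shiftedC-diag : ∀ {e} m → e ≤ m → shiftedC e m m ≡ 1
shiftedC-diag m       z≤n       = nCn≡1 m
shiftedC-diag (suc m) (s≤s e≤m) = shiftedC-diag m e≤m

shiftedC-subdiag : ∀ e m → shiftedC e (suc m) m ≡ suc m ∸ e
shiftedC-subdiag zero    m       = trans (nCk≡nC[n∸k] (n≤1+n m))
                                        (trans (cong (suc m C_) (m+n∸n≡m 1 m)) (nC1≡n (suc m)))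
shiftedC-subdiag (suc e) zero    = sym (0∸n≡0 e)
shiftedC-subdiag (suc e) (suc m) = shiftedC-subdiag e m

count-sublists-∋-last : ∀ {t} xs → t ∉ xs → ∀ q →
  count (λ G → length G ≟ q ×-dec t ∈? G) (sublists (xs ∷ʳ t)) ≡ shiftedC 1 (suc (length xs)) q
count-sublists-∋-last []            _ zero          = refl
count-sublists-∋-last {t} []        _ (suc zero)    =
  cong length (filter-accept (λ G → length G ≟ 1 ×-dec t ∈? G) {t ∷ []} {[] ∷ []} (refl , here refl))
count-sublists-∋-last []            _ (suc (suc q)) = refl
count-sublists-∋-last {t} (x ∷ xs) t∉x∷xs q = begin
  count P? (map (x ∷_) S ++ S)                  ≡⟨ count-++ P? (map (x ∷_) S) S ⟩
  count P? (map (x ∷_) S) + count P? S          ≡⟨ cong (_+ count P? S) (count-map P? (x ∷_) S) ⟩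
  count (P? ∘ (x ∷_)) S + count P? S
    ≡⟨ cong₂ _+_ (through-x q) (count-sublists-∋-last xs t∉xs q) ⟩
  shiftedC 2 (2 + L) q + shiftedC 1 (suc L) q    ≡⟨ +-comm (shiftedC 2 (2 + L) q) _ ⟩
  shiftedC 1 (suc L) q + shiftedC 2 (2 + L) q    ≡⟨ shiftedC-pascal 1 (suc L) q (λ { (() , _) }) ⟨
  shiftedC 1 (2 + L) q                          ∎
  where
  open ≡-Reasoning
  L = length xs
  S = sublists (xs ∷ʳ t)
  P? : Decidable (λ G → length G ≡ q × t ∈ G)
  P? G = length G ≟ q ×-dec t ∈? G
  t∉xs : t ∉ xs
  t∉xs = t∉x∷xs ∘ there
  through-x : ∀ q → count (λ G → length (x ∷ G) ≟ q ×-dec t ∈? (x ∷ G)) S ≡ shiftedC 2 (2 + L) q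
  through-x zero    = count-none (λ G → length (x ∷ G) ≟ 0 ×-dec t ∈? (x ∷ G)) (λ { _ (() , _) }) S
  through-x (suc q) = trans
    (count-cong (λ G → length (x ∷ G) ≟ suc q ×-dec t ∈? (x ∷ G)) (λ G → length G ≟ q ×-dec t ∈? G)
      (All.universal (λ G → mk⇔ (λ (len , t∈) → suc-injective len , Any.tail (t∉x∷xs ∘ here) t∈)
                                (λ (len , t∈) → cong suc len , there t∈)) S))
    (count-sublists-∋-last xs t∉xs q)

minList-∷ : ∀ {x} ys → All (x ≤_) ys → minList (x ∷ ys) ≡ x
minList-∷ []       []         = refl
minList-∷ (y ∷ ys) (x≤y ∷ ps) = trans (cong (y ⊓_) (minList-∷ ys ps)) (m≥n⇒m⊓n≡n x≤y)

count-maxSchreier-headed : ∀ {x t} ys → All (suc x <_) (ys ∷ʳ t) → t ∉ ys →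
  count (λ G → maxSchreier? (suc x ∷ G) ×-dec t ∈? (suc x ∷ G)) (sublists (ys ∷ʳ t))
    ≡ shiftedC 1 (suc (length ys)) x
count-maxSchreier-headed {x} {t} ys above t∉ys = trans
  (count-cong (λ G → maxSchreier? (suc x ∷ G) ×-dec t ∈? (suc x ∷ G))
              (λ G → length G ≟ x ×-dec t ∈? G)
              (All.map characterise (sublists⁺ above)))
  (count-sublists-∋-last ys t∉ys x)
  where
  t≢suc-x : t ≢ suc x
  t≢suc-x t≡suc-x = <-irrefl (sym t≡suc-x) (All.lookup above (∈-++⁺ʳ ys (here refl)))
  characterise : ∀ {G} → All (suc x <_) G →
    (MaxSchreier (suc x ∷ G) × t ∈ suc x ∷ G) ⇔ (length G ≡ x × t ∈ G)
  characterise {G} above-G = mk⇔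
    (λ ((_ , min≡len) , t∈) → suc-injective (trans (sym min≡len) min≡x) , Any.tail t≢suc-x t∈)
    (λ (len≡x , t∈) → (tt , trans min≡x (cong suc (sym len≡x))) , there t∈)
    where
    min≡x : minList (suc x ∷ G) ≡ suc x
    min≡x = minList-∷ G (All.map <⇒≤ above-G)

-- ℕ's _*_ is opened only inside this module; everywhere else _*_ is multiplication on ℤ.
module _ where
  open import Data.Nat using (_*_)
  open import Algebra.Properties.CommutativeSemigroup +-commutativeSemigroup using (interchange)

  multiplesFrom : ℕ → ℕ → ℕ → List ℕ
  multiplesFrom K a zero    = []
  multiplesFrom K a (suc m) = suc a * K ∷ multiplesFrom K (suc a) m

  length-multiplesFrom : ∀ K a m → length (multiplesFrom K a m) ≡ m
  length-multiplesFrom K a zero    = refl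
  length-multiplesFrom K a (suc m) = cong suc (length-multiplesFrom K (suc a) m)

  multiplesFrom-∷ʳ : ∀ K a m → multiplesFrom K a (suc m) ≡ multiplesFrom K a m ∷ʳ (a + suc m) * K
  multiplesFrom-∷ʳ K a zero    = cong (λ b → b * K ∷ []) (+-comm 1 a)
  multiplesFrom-∷ʳ K a (suc m) = cong (suc a * K ∷_) (trans (multiplesFrom-∷ʳ K (suc a) m)
    (cong (λ b → multiplesFrom K (suc a) m ∷ʳ b * K) (sym (+-suc a (suc m)))))

  multiples≡multiplesFrom : ∀ K n → multiples K n ≡ multiplesFrom K 0 n
  multiples≡multiplesFrom K zero    = refl
  multiples≡multiplesFrom K (suc n) = begin
    map (λ i → suc i * K) (upTo (suc n))       ≡⟨ cong (map (λ i → suc i * K)) (upTo-∷ʳ n) ⟨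
    map (λ i → suc i * K) (upTo n ∷ʳ n)        ≡⟨ map-++ (λ i → suc i * K) (upTo n) (n ∷ []) ⟩
    multiples K n ∷ʳ suc n * K                 ≡⟨ cong (_∷ʳ suc n * K) (multiples≡multiplesFrom K n) ⟩
    multiplesFrom K 0 n ∷ʳ suc n * K           ≡⟨ multiplesFrom-∷ʳ K 0 n ⟨
    multiplesFrom K 0 (suc n)                  ∎
    where open ≡-Reasoning

  multiplesFrom-lower : ∀ k' a m → All (a * suc k' <_) (multiplesFrom (suc k') a m)
  multiplesFrom-lower k' a zero    = []
  multiplesFrom-lower k' a (suc m) =
    aK<suc-aK ∷ All.map (<-trans aK<suc-aK) (multiplesFrom-lower k' (suc a) m)
    where
    aK<suc-aK : a * suc k' < suc a * suc k'
    aK<suc-aK = m<n+m (a * suc k') z<s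

  multiplesFrom-upper : ∀ k' a m {n} → a + m < n → All (_< n * suc k') (multiplesFrom (suc k') a m)
  multiplesFrom-upper k' a zero    _     = []
  multiplesFrom-upper k' a (suc m) {n} a+m<n =
    *-monoˡ-< (suc k') (≤-<-trans (s≤s (m≤m+n a m)) 1+a+m<n) ∷ multiplesFrom-upper k' (suc a) m 1+a+m<n
    where
    1+a+m<n : suc a + m < n
    1+a+m<n = subst (_< n) (+-suc a m) a+m<n

  -- schreierSum K e a m = Σ_{i<m} shiftedC e (m - i) ((a + 1 + i) K); for e = 2 its term with head jK
  -- counts the maximal Schreier sets with minimum jK that contain the last multiple.
  schreierSum : ℕ → ℕ → ℕ → ℕ → ℕ
  schreierSum K e a zero    = 0
  schreierSum K e a (suc m) = shiftedC e (suc m) (suc a * K) + schreierSum K e (suc a) m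

  count-headed-multiplesFrom : ∀ k' n a m → a + suc m ≡ n → n * suc k' ≢ 1 →
    count (λ G → counted? (suc k') n (suc a * suc k' ∷ G)) (sublists (multiplesFrom (suc k') (suc a) m))
      ≡ shiftedC 2 (suc m) (suc a * suc k')
  count-headed-multiplesFrom k' n a zero    a+1≡n nK≢1 =
    cong length (filter-reject (λ G → counted? (suc k') n (suc a * suc k' ∷ G)) {[]} {[]}
      λ ((_ , x≡1) , _) → nK≢1 (trans (cong (_* suc k') (trans (sym a+1≡n) (+-comm a 1))) x≡1))
  count-headed-multiplesFrom k' n a (suc m) a+m≡n _ = begin
    count Q? (sublists (multiplesFrom K (suc a) (suc m)))
      ≡⟨ cong (count Q? ∘ sublists) ground≡ys∷ʳnK ⟩
    count Q? (sublists (ys ∷ʳ n * K))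
      ≡⟨ count-maxSchreier-headed ys above nK∉ys ⟩
    shiftedC 1 (suc (length ys)) (k' + a * K)
      ≡⟨ cong (λ l → shiftedC 1 (suc l) (k' + a * K)) (length-multiplesFrom K (suc a) m) ⟩
    shiftedC 2 (2 + m) x ∎
    where
    open ≡-Reasoning
    K = suc k'
    x = suc a * K
    Q? = λ G → counted? K n (x ∷ G)
    ys = multiplesFrom K (suc a) m
    ground≡ys∷ʳnK : multiplesFrom K (suc a) (suc m) ≡ ys ∷ʳ n * K
    ground≡ys∷ʳnK = trans (multiplesFrom-∷ʳ K (suc a) m)
                          (cong (λ b → ys ∷ʳ b * K) (trans (sym (+-suc a (suc m))) a+m≡n))
    above : All (x <_) (ys ∷ʳ n * K)
    above = subst (All (x <_)) ground≡ys∷ʳnK (multiplesFrom-lower k' (suc a) (suc m))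
    nK∉ys : n * K ∉ ys
    nK∉ys nK∈ys = <-irrefl refl (All.lookup (multiplesFrom-upper k' (suc a) m 1+a+m<n) nK∈ys)
      where
      1+a+m<n : suc a + m < n
      1+a+m<n = ≤-reflexive (trans (sym (trans (+-suc a (suc m)) (cong suc (+-suc a m)))) a+m≡n)

  count-multiplesFrom : ∀ k' n a m → a + m ≡ n → n * suc k' ≢ 1 →
    count (counted? (suc k') n) (sublists (multiplesFrom (suc k') a m)) ≡ schreierSum (suc k') 2 a m
  count-multiplesFrom k' n a zero    _     _     = refl
  count-multiplesFrom k' n a (suc m) a+m≡n nK≢1 = begin
    count P? (map (x ∷_) S ++ S)                  ≡⟨ count-++ P? (map (x ∷_) S) S ⟩
    count P? (map (x ∷_) S) + count P? S          ≡⟨ cong (_+ count P? S) (count-map P? (x ∷_) S) ⟩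
    count (P? ∘ (x ∷_)) S + count P? S
      ≡⟨ cong₂ _+_ (count-headed-multiplesFrom k' n a m a+m≡n nK≢1)
                   (count-multiplesFrom k' n (suc a) m (trans (sym (+-suc a m)) a+m≡n) nK≢1) ⟩
    shiftedC 2 (suc m) x + schreierSum (suc k') 2 (suc a) m ∎
    where
    open ≡-Reasoning
    x = suc a * suc k'
    S = sublists (multiplesFrom (suc k') (suc a) m)
    P? = counted? (suc k') n

  s≡schreierSum : ∀ k' n → n * suc k' ≢ 1 → s (suc k') n ≡ schreierSum (suc k') 2 0 n
  s≡schreierSum k' n nK≢1 = trans
    (cong (count (counted? (suc k') n) ∘ sublists) (multiples≡multiplesFrom (suc k') n))
    (count-multiplesFrom k' n 0 n refl nK≢1)

  -- Some term of schreierSum K e a (suc m) is C(0, 0), where Pascal's rule fails.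
  Corner : ℕ → ℕ → ℕ → ℕ → Set
  Corner K e a m = ∃₂ λ b j → b + j ≡ a + m × suc b * K ≡ e × suc j ≡ e

  schreierSum-pascal : ∀ k' e a m → ¬ Corner (suc k') e a m →
    schreierSum (suc k') e a (suc m) ≡ schreierSum (suc k') e a m + schreierSum (suc k') (suc e) a (suc m)
  schreierSum-pascal k' e a zero no-corner = begin
    shiftedC e 1 x + 0
      ≡⟨ cong (_+ 0) (shiftedC-pascal e 0 x head-not-corner) ⟩
    shiftedC e 0 x + shiftedC (suc e) 1 x + 0
      ≡⟨ cong (λ c → c + shiftedC (suc e) 1 x + 0) (shiftedC-top<bottom e {0} {x} z<s) ⟩
    shiftedC (suc e) 1 x + 0 ∎
    where
    open ≡-Reasoning
    x = suc a * suc k'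
    head-not-corner : ¬ (e ≡ 1 × x ≡ 1)
    head-not-corner (e≡1 , x≡1) = no-corner (a , 0 , refl , trans x≡1 (sym e≡1) , sym e≡1)
  schreierSum-pascal k' e a (suc m) no-corner = begin
    shiftedC e (2 + m) x + schreierSum K e (suc a) (suc m)
      ≡⟨ cong₂ _+_ (shiftedC-pascal e (suc m) x head-not-corner)
                   (schreierSum-pascal k' e (suc a) m tail-not-corner) ⟩
    (shiftedC e (suc m) x + shiftedC (suc e) (2 + m) x)
      + (schreierSum K e (suc a) m + schreierSum K (suc e) (suc a) (suc m))
      ≡⟨ interchange (shiftedC e (suc m) x) _ _ _ ⟩
    (shiftedC e (suc m) x + schreierSum K e (suc a) m)
      + (shiftedC (suc e) (2 + m) x + schreierSum K (suc e) (suc a) (suc m)) ∎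
    where
    open ≡-Reasoning
    K = suc k'
    x = suc a * K
    head-not-corner : ¬ (e ≡ 2 + m × x ≡ 2 + m)
    head-not-corner (e≡ , x≡) = no-corner (a , suc m , refl , trans x≡ (sym e≡) , sym e≡)
    tail-not-corner : ¬ Corner K e (suc a) m
    tail-not-corner (b , j , b+j≡ , corner) = no-corner (b , j , trans b+j≡ (sym (+-suc a m)) , corner)

  schreierSum-shift : ∀ K e a m → schreierSum K (K + suc e) (suc a) m ≡ schreierSum K (suc e) a (m ∸ K)
  schreierSum-shift K e a zero = cong (schreierSum K (suc e) a) (sym (0∸n≡0 K))
  schreierSum-shift K e a (suc m) with K ≤? m
  ... | yes K≤m = begin
    shiftedC (K + suc e) (suc m) (K + suc a * K) + schreierSum K (K + suc e) (suc (suc a)) m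
      ≡⟨ cong₂ _+_ (trans (cong (λ t → shiftedC (K + suc e) t (K + suc a * K)) top≡)
                          (shiftedC-+ K (suc e) (suc (m ∸ K)) (suc a * K)))
                   (schreierSum-shift K e (suc a) m) ⟩
    schreierSum K (suc e) a (suc (m ∸ K))
      ≡⟨ cong (schreierSum K (suc e) a) (+-∸-assoc 1 K≤m) ⟨
    schreierSum K (suc e) a (suc m ∸ K) ∎
    where
    open ≡-Reasoning
    top≡ : suc m ≡ K + suc (m ∸ K)
    top≡ = trans (cong suc (sym (m+[n∸m]≡n K≤m))) (sym (+-suc K (m ∸ K)))
  ... | no K≰m = begin
    shiftedC (K + suc e) (suc m) (K + suc a * K) + schreierSum K (K + suc e) (suc (suc a)) m
      ≡⟨ cong₂ _+_ (shiftedC-top< (K + suc a * K) (≤-<-trans (≰⇒> K≰m) (m<m+n K z<s)))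
                   (trans (schreierSum-shift K e (suc a) m)
                          (cong (schreierSum K (suc e) (suc a)) (m≤n⇒m∸n≡0 (<⇒≤ (≰⇒> K≰m))))) ⟩
    0
      ≡⟨ cong (schreierSum K (suc e) a) (m≤n⇒m∸n≡0 (≰⇒> K≰m)) ⟨
    schreierSum K (suc e) a (suc m ∸ K) ∎
    where open ≡-Reasoning

  schreierSum-vanishes : ∀ K e a m → m < suc a * K → schreierSum K e a m ≡ 0
  schreierSum-vanishes K e a zero    _     = refl
  schreierSum-vanishes K e a (suc m) m<aK = cong₂ _+_
    (shiftedC-top<bottom e m<aK)
    (schreierSum-vanishes K e (suc a) m (<-≤-trans (<-trans (n<1+n m) m<aK) (m≤n+m (suc a * K) K)))

  schreierSum-lowered : ∀ k' n →
    schreierSum (suc k') (suc k' + 2) 0 n ≡ schreierSum (suc k') 2 0 (n ∸ suc k' ∸ 1)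
  schreierSum-lowered k' zero    = cong (λ m → schreierSum (suc k') 2 0 (m ∸ 1)) (sym (0∸n≡0 (suc k')))
  schreierSum-lowered k' (suc n) = begin
    shiftedC (K + 2) (suc n) (1 * K) + schreierSum K (K + 2) 1 n
      ≡⟨ cong₂ _+_ (shiftedC-bottom< (suc n) (≤-<-trans (≤-reflexive (+-identityʳ K)) (m<m+n K z<s)))
                   (schreierSum-shift K 1 0 n) ⟩
    schreierSum K 2 0 (n ∸ K)
      ≡⟨ cong (schreierSum K 2 0) (trans (∸-+-assoc (suc n) K 1) (cong (suc n ∸_) (+-comm K 1))) ⟨
    schreierSum K 2 0 (suc n ∸ K ∸ 1) ∎
    where
    open ≡-Reasoning
    K = suc k'

  -- k + 2 ≤ ck makes every head at distance at least c from the top exceed every level d + 2 ≤ k + 1.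
  corner-free : ∀ k' c → suc k' + 2 ≤ c * suc k' →
    ∀ d p → d < suc k' → d + c ≤ p → ¬ Corner (suc k') (d + 2) 0 p
  corner-free k' c K+2≤cK d p d<K d+c≤p (b , j , b+j≡p , head≡ , top≡) = 1+n≰n (begin
    suc k' + 2 ≤⟨ K+2≤cK ⟩
    c * K      ≤⟨ *-monoˡ-≤ K c≤1+b ⟩
    suc b * K  ≡⟨ head≡ ⟩
    d + 2      ≤⟨ +-monoˡ-≤ 2 (≤-pred d<K) ⟩
    k' + 2     ∎)
    where
    open ≤-Reasoning
    K = suc k'
    j≡1+d : j ≡ suc d
    j≡1+d = suc-injective (trans top≡ (+-comm d 2))
    c≤1+b : c ≤ suc b
    c≤1+b = +-cancelˡ-≤ d c (suc b) (begin
      d + c        ≤⟨ d+c≤p ⟩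
      p            ≡⟨ b+j≡p ⟨
      b + j        ≡⟨ cong (b +_) j≡1+d ⟩
      b + suc d    ≡⟨ +-suc b d ⟩
      suc (b + d)  ≡⟨ cong suc (+-comm b d) ⟩
      suc (d + b)  ≡⟨ +-suc d b ⟨
      d + suc b    ∎)

  -- m·k = 1 forces m = k = 1, and then 3 ≤ c·1 contradicts c ≤ 2.
  c≤1+m⇒m*[1+k']≢1 : ∀ k' c m → suc k' + 2 ≤ c * suc k' → c ≤ suc m → m * suc k' ≢ 1
  c≤1+m⇒m*[1+k']≢1 k' c m K+2≤cK c≤1+m mK≡1
    with m*n≡1⇒m≡1 m (suc k') mK≡1 | m*n≡1⇒n≡1 m (suc k') mK≡1
  ... | refl | refl = 1+n≰n (≤-trans K+2≤cK (*-monoˡ-≤ 1 c≤1+m))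

  s-vanishes-below : ∀ k' n → 1 ≤ n → n ≤ k' → s (suc k') n ≡ 0
  s-vanishes-below k' n 1≤n n≤k' = trans (s≡schreierSum k' n nK≢1)
    (schreierSum-vanishes (suc k') 2 0 n (subst (n <_) (sym (+-identityʳ (suc k'))) (s≤s n≤k')))
    where
    nK≢1 : n * suc k' ≢ 1
    nK≢1 nK≡1 with m*n≡1⇒n≡1 n (suc k') nK≡1
    ... | refl = 1+n≰n (≤-trans 1≤n n≤k')

  s-diagonal : ∀ k' → s (suc k') (suc k') ≡ 1
  s-diagonal zero     = refl
  s-diagonal (suc k') = begin
    s K K                                               ≡⟨ s≡schreierSum (suc k') K KK≢1 ⟩
    shiftedC 2 K (1 * K) + schreierSum K 2 1 (suc k')
      ≡⟨ cong₂ _+_ diagonal-term (schreierSum-vanishes K 2 1 (suc k') (m≤m+n K (K + 0))) ⟩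
    1                                                   ∎
    where
    open ≡-Reasoning
    K = suc (suc k')
    KK≢1 : K * K ≢ 1
    KK≢1 KK≡1 with m*n≡1⇒m≡1 K K KK≡1
    ... | ()
    diagonal-term : shiftedC 2 K (1 * K) ≡ 1
    diagonal-term = trans (cong (shiftedC 2 K) (+-identityʳ K)) (shiftedC-diag K (s≤s (s≤s z≤n)))

  s-after-diagonal : ∀ k' → s (suc k') (suc (suc k')) ≡ k'
  s-after-diagonal k' = begin
    s K (suc K)                                         ≡⟨ s≡schreierSum k' (suc K) 1+K*K≢1 ⟩
    shiftedC 2 (suc K) (1 * K) + schreierSum K 2 1 K
      ≡⟨ cong₂ _+_ subdiagonal-term (schreierSum-vanishes K 2 1 K (m<m+n K z<s)) ⟩
    k' + 0                                              ≡⟨ +-identityʳ k' ⟩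
    k'                                                  ∎
    where
    open ≡-Reasoning
    K = suc k'
    1+K*K≢1 : suc K * K ≢ 1
    1+K*K≢1 eq with m*n≡1⇒m≡1 (suc K) K eq
    ... | ()
    subdiagonal-term : shiftedC 2 (suc K) (1 * K) ≡ k'
    subdiagonal-term = trans (cong (shiftedC 2 (suc K)) (+-identityʳ K)) (shiftedC-subdiag 2 K)

open import Data.Integer using (ℤ; +_; _*_; -_; _-_) renaming (_+_ to _+ℤ_)
open import Data.Integer.Properties using (pos-+; neg-distrib-+)
open import Data.Integer.Tactic.RingSolver using (solve-∀)

sumℤ-shift : ∀ a l F → sumℤ (suc a) l F ≡ sumℤ a l (F ∘ suc)
sumℤ-shift a zero    F = refl
sumℤ-shift a (suc l) F = cong (F (suc a) +ℤ_) (sumℤ-shift (suc a) l F)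

sumℤ-cong : ∀ a l {F G : ℕ → ℤ} → (∀ i → F i ≡ G i) → sumℤ a l F ≡ sumℤ a l G
sumℤ-cong a zero    F≗G = refl
sumℤ-cong a (suc l) F≗G = cong₂ _+ℤ_ (F≗G a) (sumℤ-cong (suc a) l F≗G)

sumℤ-+ : ∀ a l F G → sumℤ a l (λ i → F i +ℤ G i) ≡ sumℤ a l F +ℤ sumℤ a l G
sumℤ-+ a zero    F G = refl
sumℤ-+ a (suc l) F G =
  trans (cong (F a +ℤ G a +ℤ_) (sumℤ-+ (suc a) l F G)) (interchange (F a) (G a) _ _)
  where
  interchange : ∀ w x y z → w +ℤ x +ℤ (y +ℤ z) ≡ w +ℤ y +ℤ (x +ℤ z)
  interchange = solve-∀

sumℤ-neg : ∀ a l F → sumℤ a l (λ i → - F i) ≡ - sumℤ a l F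
sumℤ-neg a zero    F = refl
sumℤ-neg a (suc l) F =
  trans (cong (- F a +ℤ_) (sumℤ-neg (suc a) l F)) (sym (neg-distrib-+ (F a) (sumℤ (suc a) l F)))

sumℤ-last-zero : ∀ a l F → F (a + l) ≡ + 0 → sumℤ a (suc l) F ≡ sumℤ a l F
sumℤ-last-zero a zero    F last≡0 = cong (_+ℤ + 0) (trans (cong F (sym (+-identityʳ a))) last≡0)
sumℤ-last-zero a (suc l) F last≡0 =
  cong (F a +ℤ_) (sumℤ-last-zero (suc a) l F (trans (cong F (sym (+-suc a l))) last≡0))

alternatingSum-vanishing-term : ∀ {t i} → t < i → ∀ x → sign i * + (t C i) * x ≡ + 0
alternatingSum-vanishing-term {t} {i} t<i x =
  trans (cong (λ c → sign i * + c * x) (k>n⇒nCk≡0 t<i)) (zero-middle (sign i) x)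
  where
  zero-middle : ∀ s x → s * + 0 * x ≡ + 0
  zero-middle = solve-∀

-- For φ i = + f (n ∸ i) this is the t-th backward difference of f at n.
alternatingSum : ℕ → (ℕ → ℤ) → ℤ
alternatingSum t φ = sumℤ 0 (suc t) (λ i → sign i * + (t C i) * φ i)

alternatingSum-suc : ∀ t φ →
  alternatingSum (suc t) φ ≡ alternatingSum t φ - alternatingSum t (φ ∘ suc)
alternatingSum-suc t φ = begin
  F 0 +ℤ sumℤ 1 (suc t) F
    ≡⟨ cong (F 0 +ℤ_) (trans (sumℤ-shift 0 (suc t) F) (sumℤ-cong 0 (suc t) pascal)) ⟩
  F 0 +ℤ sumℤ 0 (suc t) (λ i → H (suc i) +ℤ - G i)
    ≡⟨ cong (F 0 +ℤ_) (sumℤ-+ 0 (suc t) (H ∘ suc) (λ i → - G i)) ⟩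
  F 0 +ℤ (sumℤ 0 (suc t) (H ∘ suc) +ℤ sumℤ 0 (suc t) (λ i → - G i))
    ≡⟨ cong₂ (λ x y → F 0 +ℤ (x +ℤ y)) (sym (sumℤ-shift 0 (suc t) H)) (sumℤ-neg 0 (suc t) G) ⟩
  F 0 +ℤ (sumℤ 1 (suc t) H - alternatingSum t (φ ∘ suc))
    ≡⟨ assoc (F 0) (sumℤ 1 (suc t) H) (alternatingSum t (φ ∘ suc)) ⟩
  sumℤ 0 (2 + t) H - alternatingSum t (φ ∘ suc)
    ≡⟨ cong (_- alternatingSum t (φ ∘ suc)) (sumℤ-last-zero 0 (suc t) H last-vanishes) ⟩
  alternatingSum t φ - alternatingSum t (φ ∘ suc) ∎
  where
  open ≡-Reasoning
  F H G : ℕ → ℤ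
  F i = sign i * + (suc t C i) * φ i
  H i = sign i * + (t C i) * φ i
  G i = sign i * + (t C i) * φ (suc i)
  pascal : ∀ i → F (suc i) ≡ H (suc i) +ℤ - G i
  pascal i = begin
    - sign i * + (suc t C suc i) * φ (suc i)
      ≡⟨ cong (λ c → - sign i * + c * φ (suc i)) (nCk+nC[k+1]≡[n+1]C[k+1] t i) ⟨
    - sign i * + (t C i + t C suc i) * φ (suc i)
      ≡⟨ cong (λ c → - sign i * c * φ (suc i)) (pos-+ (t C i) (t C suc i)) ⟩
    - sign i * (+ (t C i) +ℤ + (t C suc i)) * φ (suc i)
      ≡⟨ distrib (sign i) (+ (t C i)) (+ (t C suc i)) (φ (suc i)) ⟩
    H (suc i) +ℤ - G i ∎
    where
    distrib : ∀ s a b x → - s * (a +ℤ b) * x ≡ - s * b * x +ℤ - (s * a * x)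
    distrib = solve-∀
  assoc : ∀ x y z → x +ℤ (y - z) ≡ x +ℤ y - z
  assoc = solve-∀
  last-vanishes : H (suc t) ≡ + 0
  last-vanishes = alternatingSum-vanishing-term (n<1+n t) (φ (suc t))

alternatingSum-cong : ∀ t {φ ψ} → (∀ i → i ≤ t → φ i ≡ ψ i) →
  alternatingSum t φ ≡ alternatingSum t ψ
alternatingSum-cong t {φ} {ψ} φ≗ψ = sumℤ-cong 0 (suc t) term
  where
  term : ∀ i → sign i * + (t C i) * φ i ≡ sign i * + (t C i) * ψ i
  term i with i ≤? t
  ... | yes i≤t = cong (sign i * + (t C i) *_) (φ≗ψ i i≤t)
  ... | no  i≰t = trans (alternatingSum-vanishing-term (≰⇒> i≰t) (φ i))
                         (sym (alternatingSum-vanishing-term (≰⇒> i≰t) (ψ i)))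

-- Pascal's rule is needed only on the triangle of levels d < t and points p ≥ d + p₀ reached from n.
alternatingSum-differences : (f : ℕ → ℕ → ℕ) (p₀ t : ℕ) →
  (∀ d p → d < t → d + p₀ ≤ p → f d (suc p) ≡ f d p + f (suc d) (suc p)) →
  ∀ n → t + p₀ ≤ n → alternatingSum t (λ i → + f 0 (n ∸ i)) ≡ + f t n
alternatingSum-differences f p₀ zero    _      n _ = unit (+ f 0 n)
  where
  unit : ∀ x → + 1 * + 1 * x +ℤ + 0 ≡ x
  unit = solve-∀
alternatingSum-differences f p₀ (suc t) pascal (suc n) (s≤s t+p₀≤n) = begin
  alternatingSum (suc t) φ                          ≡⟨ alternatingSum-suc t φ ⟩
  alternatingSum t φ - alternatingSum t (φ ∘ suc)
    ≡⟨ cong₂ _-_ (lower (suc n) (m≤n⇒m≤1+n t+p₀≤n)) (lower n t+p₀≤n) ⟩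
  + f t (suc n) - + f t n
    ≡⟨ cong (λ x → + x - + f t n) (pascal t n (n<1+n t) t+p₀≤n) ⟩
  + (f t n + f (suc t) (suc n)) - + f t n           ≡⟨ cong (_- + f t n) (pos-+ (f t n) _) ⟩
  + f t n +ℤ + f (suc t) (suc n) - + f t n          ≡⟨ cancel (+ f t n) _ ⟩
  + f (suc t) (suc n)                               ∎
  where
  open ≡-Reasoning
  φ = λ i → + f 0 (suc n ∸ i)
  lower : ∀ n → t + p₀ ≤ n → alternatingSum t (λ i → + f 0 (n ∸ i)) ≡ + f t n
  lower = alternatingSum-differences f p₀ t (λ d p d<t → pascal d p (m<n⇒m<1+n d<t))
  cancel : ∀ x y → x +ℤ y - x ≡ y
  cancel = solve-∀

alternatingSum-head : ∀ t φ →
  alternatingSum t φ ≡ φ 0 - sumℤ 1 t (λ i → sign (i + 1) * + (t C i) * φ i)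
alternatingSum-head t φ = begin
  + 1 * + 1 * φ 0 +ℤ sumℤ 1 t (λ i → sign i * + (t C i) * φ i)
    ≡⟨ cong (+ 1 * + 1 * φ 0 +ℤ_) (trans (sumℤ-cong 1 t flip-sign) (sumℤ-neg 1 t T)) ⟩
  + 1 * + 1 * φ 0 - sumℤ 1 t T
    ≡⟨ unit (φ 0) _ ⟩
  φ 0 - sumℤ 1 t T ∎
  where
  open ≡-Reasoning
  T : ℕ → ℤ
  T i = sign (i + 1) * + (t C i) * φ i
  flip-sign : ∀ i → sign i * + (t C i) * φ i ≡ - T i
  flip-sign i = trans (double-neg (sign i) _ _) (cong (λ j → - (sign j * + (t C i) * φ i)) (+-comm 1 i))
    where
    double-neg : ∀ s c x → s * c * x ≡ - (- s * c * x)
    double-neg = solve-∀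
  unit : ∀ x y → + 1 * + 1 * x +ℤ y ≡ x +ℤ y
  unit = solve-∀

-- c bounds n − k from below by enough to keep every Pascal step away from the corner.
s-recurrence-margin : ∀ k' c n → suc k' + 2 ≤ c ℕ.* suc k' → suc k' + c ≤ n →
  + s (suc k') n ≡ sumℤ 1 (suc k') (λ i → sign (i + 1) * + (suc k' C i) * + s (suc k') (n ∸ i))
                     +ℤ + s (suc k') (n ∸ suc k' ∸ 1)
s-recurrence-margin k' c n K+2≤cK K+c≤n = begin
  + s K n                                  ≡⟨ split (+ s K n) R ⟩
  R +ℤ (+ s K n - R)                       ≡⟨ cong (R +ℤ_) (alternatingSum-head K φ) ⟨
  R +ℤ alternatingSum K φ                  ≡⟨ cong (R +ℤ_) differences ⟩
  R +ℤ + s K (n ∸ K ∸ 1)                   ∎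
  where
  open ≡-Reasoning
  K = suc k'
  φ : ℕ → ℤ
  φ i = + s K (n ∸ i)
  R = sumℤ 1 K (λ i → sign (i + 1) * + (K C i) * φ i)
  split : ∀ x r → x ≡ r +ℤ (x - r)
  split = solve-∀
  c≤n∸K : c ≤ n ∸ K
  c≤n∸K = m+n≤o⇒m≤o∸n c (subst (_≤ n) (+-comm K c) K+c≤n)
  s≡schreierSum-above : ∀ m → c ≤ suc m → s K m ≡ schreierSum K 2 0 m
  s≡schreierSum-above m c≤1+m = s≡schreierSum k' m (c≤1+m⇒m*[1+k']≢1 k' c m K+2≤cK c≤1+m)
  differences : alternatingSum K φ ≡ + s K (n ∸ K ∸ 1)
  differences = begin
    alternatingSum K φ
      ≡⟨ alternatingSum-cong K (λ i i≤K → cong +_ (s≡schreierSum-above (n ∸ i)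
           (≤-trans c≤n∸K (≤-trans (∸-monoʳ-≤ n i≤K) (n≤1+n (n ∸ i)))))) ⟩
    alternatingSum K (λ i → + schreierSum K 2 0 (n ∸ i))
      ≡⟨ alternatingSum-differences (λ d → schreierSum K (d + 2) 0) c K
           (λ d p d<K d+c≤p →
              schreierSum-pascal k' (d + 2) 0 p (corner-free k' c K+2≤cK d p d<K d+c≤p))
           n K+c≤n ⟩
    + schreierSum K (K + 2) 0 n
      ≡⟨ cong +_ (schreierSum-lowered k' n) ⟩
    + schreierSum K 2 0 (n ∸ K ∸ 1)
      ≡⟨ cong +_ (s≡schreierSum-above (n ∸ K ∸ 1) (≤-trans c≤n∸K (m≤n+m∸n (n ∸ K) 1))) ⟨
    + s K (n ∸ K ∸ 1) ∎

-- For k = 1, n = 3 the recurrence involves s(1,1) = 1, the singleton {1} that escapes the binomial formula.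
s-recurrence : ∀ k' n → suc k' + 2 ≤ n →
  + s (suc k') n ≡ sumℤ 1 (suc k') (λ i → sign (i + 1) * + (suc k' C i) * + s (suc k') (n ∸ i))
                     +ℤ + s (suc k') (n ∸ suc k' ∸ 1)
s-recurrence zero     1                         (s≤s ())
s-recurrence zero     2                         (s≤s (s≤s ()))
s-recurrence zero     3                         _     = refl
s-recurrence zero     (suc (suc (suc (suc n)))) _     =
  s-recurrence-margin 0 3 (4 + n) ≤-refl (s≤s (s≤s (s≤s (s≤s z≤n))))
s-recurrence (suc k') n                         K+2≤n =
  s-recurrence-margin (suc k') 2 n (+-monoʳ-≤ (2 + k') (s≤s (s≤s z≤n))) K+2≤n

corollary1p4 : (k : ℕ) → 1 ≤ k →
    ((n : ℕ) → 1 ≤ n → n ≤ k ∸ 1 → s k n ≡ 0)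
    × s k k ≡ 1
    × s k (suc k) ≡ k ∸ 1
    × ((n : ℕ) → k + 2 ≤ n →
        + s k n ≡ sumℤ 1 k (λ i → sign (i + 1) * + (k C i) * + s k (n ∸ i))
                    +ℤ + s k (n ∸ k ∸ 1))
corollary1p4 (suc k') _ = s-vanishes-below k' , s-diagonal k' , s-after-diagonal k' , s-recurrence k'
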